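{- Let $n\ge2$, $0<k\le n/2$, and let $\alpha\in\mathcal{B}^0_{n,k}$ with normal form $p(\alpha)$. For each index $j$ with $\lambda(\alpha)_j=2$, let $g(j)$ be the unique index such that $(x_{g(j)}-x_j)$ is a factor of $p(\alpha)$. Then $g(j)$ is the largest index $i<j$ such that both $\lambda(\alpha)_i=1$ and $p(\alpha)$ contains no factor of the form $(x_i-x_m)$ with $m<j$.
   Context: $V_{n,k}$ is the $\mathbb{Q}$-vector space with basis the squarefree degree-$k$ monomials in $x_1,\dots,x_n$, ordered lexicographically: for distinct $k$-subsets $I,J$ with $t=\min(I\,\Delta\,J)$, $x_I\prec x_J$ iff $t\in I$; a nonzero $v$ is positive if the $\prec$-minimal monomial in $v$ has positive coefficient. A $k$-root is a product $\prod_{r=1}^k(\pm x_{i_{2r-1}}\pm x_{i_{2r}})$ with independent signs and $2k$ distinct indices; it is positive if positive in $V_{n,k}$. Each positive $k$-root can be written uniquely up to order of factors as $\prod_{r=1}^k(x_{i_{2r-1}}\pm x_{i_{2r}})$ with $i_{2r-1}<i_{2r}$ (normal form); factors $(x_i+x_j)$ are symmetric, indices not appearing are unused. The height is the number of symmetric factors. A positive $k$-root has a defect if its normal form has, for some $i<j<r<s$: (i) factors $(x_i\pm x_r)$ and $(x_j\pm x_s)$; (ii) a factor $(x_i\pm x_s)$ and a symmetric factor $(x_j+x_r)$; (iii) a factor $(x_i\pm x_r)$ and an unused index $j$; or (iv) a symmetric factor $(x_i+x_j)$ and an unused index $r$. $\mathcal{B}^0_{n,k}$ is the set of positive $k$-roots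 of height $0$ with no defects. The label $\lambda(\alpha)$ is the word of length $n$ over $\{1,2\}$ with $\lambda(\alpha)_j=2$ iff the normal form has a factor $(x_i-x_j)$ for some $i<j$. -}

module Defs where

open import Data.Nat using (ℕ)
open import Data.Bool using (Bool; true; false)
open import Data.Bool.Properties using () renaming (_≟_ to _≟ᵇ_)
open import Data.Fin using (Fin; _<_; _≟_)
open import Data.List using (List; []; _∷_; concatMap; length)
open import Data.List.Relation.Unary.Any using (Any; any?)
open import Data.List.Relation.Unary.All using (All)
open import Data.List.Relation.Unary.Unique.Propositional using (Unique)
open import Data.Product using (_×_; ∃-syntax)
open import Relation.Nullary using (¬_; does)
open import Relation.Nullary.Decidable using (_×-dec_)
open import Relation.Binary.PropositionalEquality using (_≡_)

-- A factor (x_lo ± x_hi) of a normal form, indices 0-based in Fin n, lo < hi.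
-- sym = true  means the symmetric factor (x_lo + x_hi),
-- sym = false means the factor (x_lo - x_hi).
record Factor (n : ℕ) : Set where
  constructor fac
  field
    lo  : Fin n
    hi  : Fin n
    lo<hi : lo < hi
    sym : Bool
open Factor public

indices : {n : ℕ} → List (Factor n) → List (Fin n)
indices = concatMap (λ f → lo f ∷ hi f ∷ [])

-- A positive k-root, represented by its (unique up to order) normal form:
-- k factors (x_i ± x_j), i < j, with 2k distinct indices.
record NormalForm (n k : ℕ) : Set where
  constructor nf
  field
    factors  : List (Factor n)
    len      : length factors ≡ k
    distinct : Unique (indices factors)
open NormalForm public

HasFactor : {n k : ℕ} → NormalForm n k → Fin n → Fin n → Bool → Set
HasFactor p i j s = Any (λ f → lo f ≡ i × hi f ≡ j × sym f ≡ s) (factors p)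

HasFactor± : {n k : ℕ} → NormalForm n k → Fin n → Fin n → Set
HasFactor± p i j = ∃[ s ] HasFactor p i j s

Unused : {n k : ℕ} → NormalForm n k → Fin n → Set
Unused p i = ¬ Any (λ f → lo f ≡ i) (factors p) × ¬ Any (λ f → hi f ≡ i) (factors p)

HeightZero : {n k : ℕ} → NormalForm n k → Set
HeightZero p = All (λ f → sym f ≡ false) (factors p)

-- Defects (i)-(iv); each condition only involves the indices it mentions.
data Defect {n k : ℕ} (p : NormalForm n k) : Set where
  defect-i   : (i j r s : Fin n) → i < j → j < r → r < s →
               HasFactor± p i r → HasFactor± p j s → Defect p
  defect-ii  : (i j r s : Fin n) → i < j → j < r → r < s →
               HasFactor± p i s → HasFactor p j r true → Defect p
  defect-iii : (i j r : Fin n) → i < j → j < r →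
               HasFactor± p i r → Unused p j → Defect p
  defect-iv  : (i j r : Fin n) → i < j → j < r →
               HasFactor p i j true → Unused p r → Defect p

InB0 : {n k : ℕ} → NormalForm n k → Set
InB0 p = HeightZero p × ¬ Defect p

label : {n k : ℕ} → NormalForm n k → Fin n → ℕ
label p j with does (any? (λ f → (hi f ≟ j) ×-dec (sym f ≟ᵇ false)) (factors p))
... | true  = 2
... | false = 1

module Submission where

-- Since the 2k indices of a normal form are distinct, each index lies in exactly one
-- factor; this gives g < j, λ_g = 1 (g already starts the factor (x_g - x_j)) and that
-- the only difference starting at g ends at j. For maximality take g < i < j with λ_i = 1.
-- At height 0, i is then either unused, which is defect (iii) against (x_g - x_j), or
-- starts a factor (x_i - x_m): m = j would repeat the index j, and m > j is defect (i),
-- so m < j and i is excluded.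

open import Defs
open import Data.Nat using (ℕ; _≤_; _*_)
import Data.Nat.Properties as ℕ
open import Data.Bool using (Bool; false)
open import Data.Bool.Properties using () renaming (_≟_ to _≟ᵇ_)
open import Data.Fin using (Fin; _<_; _≟_)
open import Data.Fin.Properties using (<-cmp; <⇒≢)
open import Data.List using (List; _∷_)
open import Data.List.Membership.Propositional using (_∈_; find; lose)
open import Data.List.Relation.Unary.Any using (here; there; any?)
import Data.List.Relation.Unary.Any as Any
import Data.List.Relation.Unary.All as All
open import Data.List.Relation.Unary.All.Properties using (All¬⇒¬Any)
open import Data.List.Relation.Unary.AllPairs using (_∷_)
open import Data.List.Relation.Unary.Unique.Propositional using (Unique)
open import Data.Product using (_×_; ∃-syntax; _,_; proj₂)
open import Data.Sum using (_⊎_; inj₁; inj₂; [_,_]′)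
open import Relation.Nullary using (¬_; yes; no)
open import Relation.Nullary.Decidable using (_×-dec_)
open import Relation.Binary using (tri<; tri≈; tri>)
open import Relation.Binary.PropositionalEquality using (_≡_; refl; cong)
import Relation.Binary.PropositionalEquality as ≡

Occurs : {n : ℕ} → Fin n → Factor n → Set
Occurs x f = lo f ≡ x ⊎ hi f ≡ x

module _ {n : ℕ} where

  ∈-indices : {x : Fin n} {f : Factor n} {fs : List (Factor n)} →
    f ∈ fs → Occurs x f → x ∈ indices fs
  ∈-indices (here refl) (inj₁ refl) = here refl
  ∈-indices (here refl) (inj₂ refl) = there (here refl)
  ∈-indices (there f∈fs) x∈f = there (there (∈-indices f∈fs x∈f))

  head-indices-fresh : {x : Fin n} {f : Factor n} {fs : List (Factor n)} →
    Unique (indices (f ∷ fs)) → Occurs x f → ¬ x ∈ indices fs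
  head-indices-fresh (lo∉ ∷ _ ∷ _) (inj₁ refl) = All¬⇒¬Any (All.tail lo∉)
  head-indices-fresh (_ ∷ hi∉ ∷ _) (inj₂ refl) = All¬⇒¬Any hi∉

  shared-index⇒≡ : {x : Fin n} {f f′ : Factor n} {fs : List (Factor n)} →
    Unique (indices fs) → f ∈ fs → f′ ∈ fs → Occurs x f → Occurs x f′ → f ≡ f′
  shared-index⇒≡ _ (here refl) (here refl) _ _ = refl
  shared-index⇒≡ {fs = f ∷ fs} u (here refl) (there f′∈) x∈f x∈f′
    with () ← head-indices-fresh {f = f} {fs = fs} u x∈f (∈-indices f′∈ x∈f′)
  shared-index⇒≡ {fs = f ∷ fs} u (there f∈) (here refl) x∈f x∈f′
    with () ← head-indices-fresh {f = f} {fs = fs} u x∈f′ (∈-indices f∈ x∈f)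
  shared-index⇒≡ (_ ∷ _ ∷ u) (there f∈) (there f′∈) x∈f x∈f′ = shared-index⇒≡ u f∈ f′∈ x∈f x∈f′

module _ {n k : ℕ} (p : NormalForm n k) where

  HasFactor⇒< : {i j : Fin n} {s : Bool} → HasFactor p i j s → i < j
  HasFactor⇒< h with find h
  ... | f , _ , refl , refl , _ = lo<hi f

  HasFactor-lo-injective : {i j j′ : Fin n} {s s′ : Bool} →
    HasFactor p i j s → HasFactor p i j′ s′ → j ≡ j′
  HasFactor-lo-injective h h′ with find h | find h′
  ... | f , f∈ , refl , refl , _ | f′ , f′∈ , e , refl , _ =
    cong hi (shared-index⇒≡ (distinct p) f∈ f′∈ (inj₁ refl) (inj₁ e))

  HasFactor-hi-injective : {i i′ j : Fin n} {s s′ : Bool} →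
    HasFactor p i j s → HasFactor p i′ j s′ → i ≡ i′
  HasFactor-hi-injective h h′ with find h | find h′
  ... | f , f∈ , refl , refl , _ | f′ , f′∈ , refl , e , _ =
    cong lo (shared-index⇒≡ (distinct p) f∈ f′∈ (inj₂ refl) (inj₂ e))

  HasFactor-lo⇒¬hi : {i j m : Fin n} {s s′ : Bool} →
    HasFactor p i j s → ¬ HasFactor p m i s′
  HasFactor-lo⇒¬hi h h′ with find h | find h′
  ... | f , f∈ , refl , refl , _ | f′ , f′∈ , refl , e , _
    with refl ← shared-index⇒≡ (distinct p) f∈ f′∈ (inj₁ refl) (inj₂ e)
    = <⇒≢ (lo<hi f) (≡.sym e)

  label≡1⇒¬HasFactor : {i j : Fin n} → label p j ≡ 1 → ¬ HasFactor p i j false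
  label≡1⇒¬HasFactor {j = j} label≡1 h
    with any? (λ f → (hi f ≟ j) ×-dec (sym f ≟ᵇ false)) (factors p) | label≡1
  ... | yes _ | ()
  ... | no ¬into | _ = ¬into (Any.map proj₂ h)

  ¬HasFactor⇒label≡1 : {j : Fin n} → (∀ i → ¬ HasFactor p i j false) → label p j ≡ 1
  ¬HasFactor⇒label≡1 {j} ¬into
    with any? (λ f → (hi f ≟ j) ×-dec (sym f ≟ᵇ false)) (factors p)
  ... | no _ = refl
  ... | yes into with find into
  ...   | f , f∈ , hi≡j , sym≡false with () ← ¬into (lo f) (lose f∈ (refl , hi≡j , sym≡false))

  heightZero-index-role : HeightZero p → (i : Fin n) →
    (∃[ m ] HasFactor p i m false) ⊎ (∃[ m ] HasFactor p m i false) ⊎ Unused p i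
  heightZero-index-role hz i
    with any? (λ f → lo f ≟ i) (factors p) | any? (λ f → hi f ≟ i) (factors p)
  ... | yes lo≡i | _ with find lo≡i
  ...   | f , f∈ , refl = inj₁ (hi f , lose f∈ (refl , refl , All.lookup hz f∈))
  heightZero-index-role hz i | no _ | yes hi≡i with find hi≡i
  ...   | f , f∈ , refl = inj₂ (inj₁ (lo f , lose f∈ (refl , refl , All.lookup hz f∈)))
  heightZero-index-role hz i | no lo≢i | no hi≢i = inj₂ (inj₂ (lo≢i , hi≢i))

  inside-difference : InB0 p → {g i j : Fin n} → HasFactor p g j false → g < i → i < j →
    (∃[ m ] (m < j × HasFactor p i m false)) ⊎ (∃[ m ] HasFactor p m i false)
  inside-difference (hz , no-defect) {g} {i} {j} hg g<i i<j with heightZero-index-role hz i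
  ... | inj₂ (inj₁ into-i) = inj₂ into-i
  ... | inj₂ (inj₂ unused) with () ← no-defect (defect-iii g i j g<i i<j (false , hg) unused)
  ... | inj₁ (m , hm) with <-cmp m j
  ...   | tri< m<j _ _ = inj₁ (m , m<j , hm)
  ...   | tri≈ _ refl _ with () ← <⇒≢ g<i (HasFactor-hi-injective hg hm)
  ...   | tri> _ _ j<m with () ← no-defect (defect-i g i j m g<i i<j j<m (false , hg) (false , hm))

lemma3p7 : (n k : ℕ) → 2 ≤ n → 1 ≤ k → 2 * k ≤ n →
    (p : NormalForm n k) → InB0 p →
    (j : Fin n) → label p j ≡ 2 →
    (g : Fin n) → HasFactor p g j false →
      (g < j × label p g ≡ 1 × ¬ (∃[ m ] (m < j × HasFactor p g m false)))
      × ((i : Fin n) → i < j → label p i ≡ 1 →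
           ¬ (∃[ m ] (m < j × HasFactor p i m false)) → i Data.Fin.≤ g)
lemma3p7 n k _ _ _ p b0 j _ g hg =
  (HasFactor⇒< p hg , label-g , no-earlier-difference) , maximal
  where
  label-g : label p g ≡ 1
  label-g = ¬HasFactor⇒label≡1 p (λ _ → HasFactor-lo⇒¬hi p hg)

  no-earlier-difference : ¬ (∃[ m ] (m < j × HasFactor p g m false))
  no-earlier-difference (m , m<j , hm) = <⇒≢ m<j (≡.sym (HasFactor-lo-injective p hg hm))

  maximal : (i : Fin n) → i < j → label p i ≡ 1 →
    ¬ (∃[ m ] (m < j × HasFactor p i m false)) → i Data.Fin.≤ g
  maximal i i<j label-i no-difference = ℕ.≮⇒≥ λ g<i →
    [ no-difference , (λ (m , hm) → label≡1⇒¬HasFactor p label-i hm) ]′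
      (inside-difference p b0 hg g<i i<j)
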